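{- Let $k\ge1$ and $n\ge0$ be integers and let $x=(n+1)F_{2k}+\lfloor n/\phi\rfloor F_{2k-1}$. If $n=0$ or $n=\lfloor m\phi\rfloor+1$ for some integer $m\ge1$, then $x\in B_{2k}^{(1)}$. If $n=\lfloor m\phi^2\rfloor+1$ for some integer $m\ge0$, then $x\in B_{2k}^{(2)}$.
   Context: $F_i$ are the Fibonacci numbers ($F_0=0,F_1=1,F_{m+1}=F_m+F_{m-1}$), $\phi=(1+\sqrt5)/2$. Chung–Graham representation: every nonnegative integer $n$ is uniquely $n=\sum_{j\ge1}c_jF_{2j}$ with $c_j\in\{0,1,2\}$ such that whenever $j<j'$ and $c_j=c_{j'}=2$ there is $j''$ with $j<j''<j'$ and $c_{j''}=0$. $B_{2k}$ is the set of positive integers whose Chung–Graham representation has $c_k\neq0$ and $c_j=0$ for all $j<k$; $B_{2k}^{(1)}$ (resp. $B_{2k}^{(2)}$) is the subset of $B_{2k}$ with $c_k=1$ (resp. $c_k=2$). -}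

module Defs where

open import Data.Nat using (ℕ; zero; suc; _+_; _*_; _∸_; _≤_; _<_)
open import Data.List using (List; []; _∷_)
open import Data.List.Relation.Unary.All using (All)
open import Data.Product using (_×_; ∃-syntax)
open import Relation.Binary.PropositionalEquality using (_≡_)

F : ℕ → ℕ
F zero = 0
F (suc zero) = 1
F (suc (suc m)) = F (suc m) + F m

-- Floors of the irrational quantities, phi = (1 + √5)/2.
-- "q = ⌊α⌋" is stated literally as  q ≤ α < q + 1, with each comparison
-- between a rational and a number of the form (a + b√5)/2 cleared of
-- denominators and square roots (exact, integer arithmetic).

-- q = ⌊ m φ ⌋ ,  m φ = (m + m√5)/2 :
--   q ≤ mφ      ⟺  2q − m ≤ m√5      ⟺  (2q ∸ m)² ≤ 5m²
--   mφ < q + 1  ⟺  m√5 < 2q + 2 − m  ⟺  m < 2q+2  ∧  5m² < (2q+2 ∸ m)²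
IsFloorMulPhi : ℕ → ℕ → Set
IsFloorMulPhi m q =
  ((2 * q ∸ m) * (2 * q ∸ m) ≤ 5 * (m * m))
  × (m < 2 * q + 2 × 5 * (m * m) < (2 * q + 2 ∸ m) * (2 * q + 2 ∸ m))

-- q = ⌊ m φ² ⌋ ,  m φ² = (3m + m√5)/2 :
IsFloorMulPhi² : ℕ → ℕ → Set
IsFloorMulPhi² m q =
  ((2 * q ∸ 3 * m) * (2 * q ∸ 3 * m) ≤ 5 * (m * m))
  × (3 * m < 2 * q + 2 × 5 * (m * m) < (2 * q + 2 ∸ 3 * m) * (2 * q + 2 ∸ 3 * m))

-- q = ⌊ n / φ ⌋ ,  n / φ = (n√5 − n)/2 :
--   q ≤ n/φ      ⟺  2q + n ≤ n√5      ⟺  (2q + n)² ≤ 5n²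
--   n/φ < q + 1  ⟺  n√5 < 2q + 2 + n  ⟺  5n² < (2q + 2 + n)²
IsFloorDivPhi : ℕ → ℕ → Set
IsFloorDivPhi n q =
  ((2 * q + n) * (2 * q + n) ≤ 5 * (n * n))
  × (5 * (n * n) < (2 * q + 2 + n) * (2 * q + 2 + n))

-- Chung–Graham representations.
-- A digit list  cs = c₁ ∷ c₂ ∷ … ∷ c_L ∷ []  stands for the sequence
-- (c_j)_{j ≥ 1} with c_j = 0 for j > L.

-- digit cs j = c_j  (j ≥ 1; digit cs 0 is an unused dummy value 0)
digit : List ℕ → ℕ → ℕ
digit cs zero = 0
digit [] (suc j) = 0
digit (c ∷ cs) (suc zero) = c
digit (c ∷ cs) (suc (suc j)) = digit cs (suc j)

valueFrom : ℕ → List ℕ → ℕ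
valueFrom j [] = 0
valueFrom j (c ∷ cs) = c * F (2 * j) + valueFrom (suc j) cs

value : List ℕ → ℕ
value = valueFrom 1

IsCGRep : List ℕ → Set
IsCGRep cs =
  All (λ c → c ≤ 2) cs
  × (∀ j j' → 1 ≤ j → j < j' → digit cs j ≡ 2 → digit cs j' ≡ 2 →
       ∃[ j'' ] (j < j'' × j'' < j' × digit cs j'' ≡ 0))

-- x ∈ B_{2k}^{(d)}: x positive and its Chung–Graham representation has
-- c_k = d and c_j = 0 for all j < k.  (The representation is unique,
-- so "its representation" is rendered as "some CG representation".)
InB : ℕ → ℕ → ℕ → Set
InB d k x =
  0 < x × ∃[ cs ] (IsCGRep cs × value cs ≡ x × digit cs k ≡ d
                   × (∀ j → 1 ≤ j → j < k → digit cs j ≡ 0))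

InB⁽¹⁾ : ℕ → ℕ → Set
InB⁽¹⁾ = InB 1

InB⁽²⁾ : ℕ → ℕ → Set
InB⁽²⁾ = InB 2

module Submission where

-- Write f = ⌊n/φ⌋. Every N has a Chung–Graham representation whose shifted value
-- Σ c_j F_{2j−2} is ⌊N/φ²⌋: writing v = ⌊N/φ²⌋ and w = ⌊v/φ²⌋, the representation of N is
-- the digit N + w − 3v followed by the representation of v. Putting a digit d in front of the
-- representation t of f and moving it up to position k gives a representation of
-- (n + 1)F_{2k} + f F_{2k−1} as soon as value (d ∷ t) = n + 1 + f, i.e. n + 1 + ⌊f/φ²⌋ = 2f + d.
-- The floor hypotheses force the left-hand side to be 2f + 1 in the first case and 2f + 2 in
-- the second, where they also show that a 2 may precede t.
-- All comparisons with irrational numbers are comparisons of elements a + bφ of ℤ[φ] with 0.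

open import Data.Bool using (Bool; true; false)
open import Data.List using (List; []; _∷_; _++_; replicate)
open import Data.Nat as ℕ using (ℕ; zero; suc; z≤n; s≤s)
import Data.Nat.Properties as ℕₚ
open import Data.Nat.Induction using (<-rec)
open import Data.Integer using (ℤ; +_; -_; _-_; +0; 1ℤ; -[1+_]; +[1+_]; +<+; +≤+)
import Data.Integer.Properties as ℤₚ
open import Data.Product using (_×_; _,_; ∃-syntax; proj₁)
open import Data.Sum using (_⊎_; inj₁; inj₂)
open import Relation.Nullary using (yes; no; contradiction)
open import Relation.Binary.Definitions using (tri<; tri≈; tri>)
open import Relation.Binary.PropositionalEquality
  using (_≡_; refl; sym; trans; cong; cong₂; subst; subst₂)
open import Relation.Binary.PropositionalEquality.Properties using (module ≡-Reasoning)

open import Defs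

-- Posφ a b means a + bφ > 0. As a F_j + b F_{j+1} = ((a + bφ)φ^j − (a + bφ̄)φ̄^j)/√5 with
-- |φ̄| < 1, this is the eventual sign of that sequence, and by the Fibonacci recurrence two
-- consecutive positive terms make every later term positive.
module ℤφ where
  open import Data.Integer using (_+_; _*_; _<_; _≤_)
  open import Data.Integer.Tactic.RingSolver using (solve-∀)

  fibCombination : ℤ → ℤ → ℕ → ℤ
  fibCombination a b j = a * + F j + b * + F (suc j)

  record PosφFrom (a b : ℤ) (j : ℕ) : Set where
    constructor _,_
    field
      here : +0 < fibCombination a b j
      next : +0 < fibCombination a b (suc j)

  record Posφ (a b : ℤ) : Set where
    constructor posφ
    field
      {start} : ℕ
      from : PosφFrom a b start

  data NonNegφ : ℤ → ℤ → Set where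
    positive : ∀ {a b} → Posφ a b → NonNegφ a b
    null     : NonNegφ +0 +0

  -- The equations come last, so that a `solve` proving them meets goals without metavariables.
  posφ-cong : ∀ {a b a′ b′} → Posφ a b → a ≡ a′ → b ≡ b′ → Posφ a′ b′
  posφ-cong p refl refl = p

  nonNegφ-cong : ∀ {a b a′ b′} → NonNegφ a b → a ≡ a′ → b ≡ b′ → NonNegφ a′ b′
  nonNegφ-cong p refl refl = p

  nonNegφ⇒posφ : ∀ {a m} → NonNegφ a (+ suc m) → Posφ a (+ suc m)
  nonNegφ⇒posφ (positive p) = p

  fibCombination-suc-suc : ∀ a b j →
    fibCombination a b (suc (suc j)) ≡ fibCombination a b (suc j) + fibCombination a b j
  fibCombination-suc-suc a b j = expand a b (+ F (suc j)) (+ F j)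
    where
    expand : ∀ a b x y → a * (x + y) + b * ((x + y) + x) ≡ (a * x + b * (x + y)) + (a * y + b * x)
    expand = solve-∀

  posφFrom-suc : ∀ {a b j} → PosφFrom a b j → PosφFrom a b (suc j)
  posφFrom-suc {a} {b} {j} (p , q) =
    q , subst (+0 <_) (sym (fibCombination-suc-suc a b j)) (ℤₚ.+-mono-< q p)

  posφFrom-later : ∀ {a b j} d → PosφFrom a b j → PosφFrom a b (d ℕ.+ j)
  posφFrom-later zero p = p
  posφFrom-later (suc d) p = posφFrom-suc (posφFrom-later d p)

  posφFrom-+ : ∀ {a b a′ b′ j} → PosφFrom a b j → PosφFrom a′ b′ j → PosφFrom (a + a′) (b + b′) j
  posφFrom-+ {a} {b} {a′} {b′} {j} (p , q) (p′ , q′) =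
    subst (+0 <_) (sym (fibCombination-+ j)) (ℤₚ.+-mono-< p p′) ,
    subst (+0 <_) (sym (fibCombination-+ (suc j))) (ℤₚ.+-mono-< q q′)
    where
    distrib : ∀ a b a′ b′ x y → (a + a′) * x + (b + b′) * y ≡ (a * x + b * y) + (a′ * x + b′ * y)
    distrib = solve-∀
    fibCombination-+ : ∀ i →
      fibCombination (a + a′) (b + b′) i ≡ fibCombination a b i + fibCombination a′ b′ i
    fibCombination-+ i = distrib a b a′ b′ (+ F i) (+ F (suc i))

  posφ-+ : ∀ {a b a′ b′} → Posφ a b → Posφ a′ b′ → Posφ (a + a′) (b + b′)
  posφ-+ {a′ = a′} {b′} (posφ {start = j} p) (posφ {start = j′} p′) = posφ {start = j′ ℕ.+ j}
    (posφFrom-+ (posφFrom-later j′ p) (subst (PosφFrom a′ b′) (ℕₚ.+-comm j j′) (posφFrom-later j p′)))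

  posφ-+-nonNegφ : ∀ {a b a′ b′} → Posφ a b → NonNegφ a′ b′ → Posφ (a + a′) (b + b′)
  posφ-+-nonNegφ p (positive q) = posφ-+ p q
  posφ-+-nonNegφ {a} {b} p null = posφ-cong p (sym (ℤₚ.+-identityʳ a)) (sym (ℤₚ.+-identityʳ b))

  posφ-*φ : ∀ {a b} → Posφ a b → Posφ b (a + b)
  posφ-*φ {a} {b} (posφ {start = j} p) with posφFrom-suc p
  ... | p₁ , p₂ = posφ {start = j} (subst (+0 <_) (shift j) p₁ , subst (+0 <_) (shift (suc j)) p₂)
    where
    rearrange : ∀ a b x y → a * x + b * (x + y) ≡ b * y + (a + b) * x
    rearrange = solve-∀
    shift : ∀ j → fibCombination a b (suc j) ≡ fibCombination b (a + b) j
    shift j = rearrange a b (+ F (suc j)) (+ F j)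

  posφ-/φ : ∀ {a b} → Posφ a b → Posφ (b - a) a
  posφ-/φ {a} {b} (posφ {start = j} (p₁ , p₂)) =
    posφ {start = suc j} (subst (+0 <_) (shift j) p₁ , subst (+0 <_) (shift (suc j)) p₂)
    where
    rearrange : ∀ a b x y → a * y + b * x ≡ (b - a) * x + a * (x + y)
    rearrange = solve-∀
    shift : ∀ j → fibCombination a b j ≡ fibCombination (b - a) a (suc j)
    shift j = rearrange a b (+ F (suc j)) (+ F j)

  nonNegφ-/φ : ∀ {a b} → NonNegφ a b → NonNegφ (b - a) a
  nonNegφ-/φ (positive p) = positive (posφ-/φ p)
  nonNegφ-/φ null = null

  posφ⇒0< : ∀ {a} → Posφ a +0 → +0 < a
  posφ⇒0< {a} (posφ {start = j} (p , _)) with +0 ℤₚ.<? a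
  ... | yes 0<a = 0<a
  ... | no 0≮a = contradiction (subst (+0 <_) (ℤₚ.+-identityʳ (a * + F j)) p)
    (ℤₚ.≤⇒≯ (ℤₚ.*-monoʳ-≤-nonNeg (+ F j) (ℤₚ.≮⇒≥ 0≮a)))

  i<j⇒0<j-i : ∀ {i j} → i < j → +0 < j - i
  i<j⇒0<j-i {i} {j} i<j = subst (_< j - i) (ℤₚ.+-inverseʳ i) (ℤₚ.+-monoˡ-< (- i) i<j)

  0<j-i⇒i<j : ∀ {i j} → +0 < j - i → i < j
  0<j-i⇒i<j {i} {j} 0<j-i = subst₂ _<_ (ℤₚ.+-identityˡ i) (cancel j i) (ℤₚ.+-monoˡ-< i 0<j-i)
    where
    cancel : ∀ j i → j - i + i ≡ j
    cancel = solve-∀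

  <-from-posφ : ∀ {a b x y} → Posφ a b → a ≡ y - x → b ≡ +0 → x < y
  <-from-posφ p refl refl = 0<j-i⇒i<j (posφ⇒0< p)

  -- a + bφ ≥ a + b when b ≥ 0
  posφ-from-0<a+b : ∀ {a b} → +0 ≤ b → +0 < a + b → Posφ a b
  posφ-from-0<a+b {a} {b} 0≤b 0<a+b = posφ {start = 1}
    (subst (+0 <_) (sym (at1 a b)) 0<a+b , subst (+0 <_) (sym (at2 a b)) (ℤₚ.+-mono-<-≤ 0<a+b 0≤b))
    where
    at1 : ∀ a b → a * + 1 + b * + 1 ≡ a + b
    at1 = solve-∀
    at2 : ∀ a b → a * + 1 + b * + 2 ≡ (a + b) + b
    at2 = solve-∀

  posφ-ℕ : ∀ {a b} → 0 ℕ.< a ℕ.+ b → Posφ (+ a) (+ b)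
  posφ-ℕ 0<a+b = posφ-from-0<a+b (+≤+ z≤n) (+<+ 0<a+b)

  <⇒<φ : ∀ {x y} → x ℕ.< y → Posφ (- + x) (+ y)
  <⇒<φ {x} {y} x<y =
    posφ-from-0<a+b (+≤+ z≤n) (subst (+0 <_) (ℤₚ.+-comm (+ y) (- + x)) (i<j⇒0<j-i (+<+ x<y)))

  posφ-1 : Posφ (+ 1) +0
  posφ-1 = posφ-ℕ (s≤s z≤n)

  posφ-φ : Posφ +0 (+ 1)
  posφ-φ = posφ-ℕ (s≤s z≤n)

  -- 1/φ² = 2 − φ
  posφ-φ⁻² : Posφ (+ 2) (- + 1)
  posφ-φ⁻² = posφ {start = 3} (+<+ (s≤s z≤n) , +<+ (s≤s z≤n))

  posφ-/φ-< : ∀ {y z} → Posφ (+ y) (- + z) → Posφ (- + (y ℕ.+ z)) (+ y)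
  posφ-/φ-< {y} {z} y>zφ = posφ-cong (posφ-/φ y>zφ) (neg-sum (+ y) (+ z)) refl
    where
    neg-sum : ∀ y z → - z - y ≡ - (y + z)
    neg-sum = solve-∀

  posφ-/φ-> : ∀ {y z} → Posφ (- + y) (+ z) → Posφ (+ (y ℕ.+ z)) (- + y)
  posφ-/φ-> {y} {z} y<zφ = posφ-cong (posφ-/φ y<zφ) (double-neg (+ y) (+ z)) refl
    where
    double-neg : ∀ y z → z - - y ≡ y + z
    double-neg = solve-∀

module ComparisonWithφ where
  open import Data.Nat using (_+_; _*_; _≤_; _<_; _<?_)
  open import Data.Nat.Tactic.RingSolver using (solve-∀)
  open ℤφ

  record ComparedWithφ (x y : ℕ) : Set where
    constructor compared
    field
      below : x * x < x * y + y * y → Posφ (- + x) (+ y)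
      above : x * y + y * y < x * x → Posφ (+ x) (- + y)
      equal : x * x ≡ x * y + y * y → x ≡ 0 × y ≡ 0

  -- For x = y + z: x² − xy − y² = −(y² − yz − z²) and −x + yφ = (y − zφ)/φ, so comparing x
  -- with yφ amounts to the opposite comparison of y with zφ, for a smaller pair.
  comparedWithφ-fuel : ∀ s x y → x + y ≤ s → ComparedWithφ x y
  comparedWithφ-fuel s zero zero _ = compared (λ ()) (λ ()) (λ _ → refl , refl)
  comparedWithφ-fuel s (suc x) zero _ = compared
    (λ h → contradiction (subst (suc x * suc x <_) xy+y²≡0 h) λ ())
    (λ _ → posφ-ℕ (s≤s z≤n))
    (λ h → contradiction (trans h xy+y²≡0) λ ())
    where
    xy+y²≡0 : suc x * 0 + 0 ≡ 0
    xy+y²≡0 = trans (ℕₚ.+-identityʳ _) (ℕₚ.*-zeroʳ (suc x))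
  comparedWithφ-fuel s x (suc y) _ with x <? suc y
  ... | yes x<y = compared
    (λ _ → <⇒<φ x<y)
    (λ h → contradiction (ℕₚ.≤-trans x²≤xy (ℕₚ.m≤m+n _ _)) (ℕₚ.<⇒≱ h))
    (λ h → contradiction (ℕₚ.≤-<-trans x²≤xy (ℕₚ.m<m+n _ (s≤s z≤n))) (ℕₚ.<-irrefl h))
    where
    x²≤xy : x * x ≤ x * suc y
    x²≤xy = ℕₚ.*-monoʳ-≤ x (ℕₚ.<⇒≤ x<y)
  comparedWithφ-fuel zero x (suc y) x+y≤0 | no _ =
    contradiction (ℕₚ.n≤0⇒n≡0 x+y≤0) (ℕₚ.m+1+n≢0 x)
  comparedWithφ-fuel (suc s) x y@(suc y′) x+y≤s | no x≮y
    with ℕₚ.m≤n⇒∃[o]m+o≡n (ℕₚ.≮⇒≥ x≮y)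
  ... | z , refl = compared
    (λ h → posφ-/φ-< (above (flip-< h)))
    (λ h → posφ-/φ-> (below (flip-> h)))
    (λ h → contradiction (proj₁ (equal (flip-≡ h))) λ ())
    where
    y+z≤s : y + z ≤ s
    y+z≤s = ℕₚ.≤-trans (ℕₚ.m≤m+n (y + z) y′)
      (ℕₚ.≤-pred (subst (_≤ suc s) (ℕₚ.+-suc (y + z) y′) x+y≤s))
    open ComparedWithφ (comparedWithφ-fuel s y z y+z≤s)
    square-≡ : ∀ y z → (y + z) * (y + z) ≡ (y * z + z * z) + (y * y + y * z)
    square-≡ = solve-∀
    cross-≡ : ∀ y z → (y + z) * y + y * y ≡ y * y + (y * y + y * z)
    cross-≡ = solve-∀
    square = square-≡ y z
    cross = cross-≡ y z
    flip-< : (y + z) * (y + z) < (y + z) * y + y * y → y * z + z * z < y * y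
    flip-< h = ℕₚ.+-cancelʳ-< _ _ _ (subst₂ _<_ square cross h)
    flip-> : (y + z) * y + y * y < (y + z) * (y + z) → y * y < y * z + z * z
    flip-> h = ℕₚ.+-cancelʳ-< _ _ _ (subst₂ _<_ cross square h)
    flip-≡ : (y + z) * (y + z) ≡ (y + z) * y + y * y → y * y ≡ y * z + z * z
    flip-≡ h = ℕₚ.+-cancelʳ-≡ _ _ _ (trans (sym cross) (trans (sym h) square))

  comparedWithφ : ∀ x y → ComparedWithφ x y
  comparedWithφ x y = comparedWithφ-fuel (x + y) x y ℕₚ.≤-refl

  module _ {x y : ℕ} where
    open ComparedWithφ (comparedWithφ x y)

    ≤φ-by-squares : x * x ≤ x * y + y * y → NonNegφ (- + x) (+ y)
    ≤φ-by-squares x²≤xy+y² with ℕₚ.m≤n⇒m<n∨m≡n x²≤xy+y²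
    ... | inj₁ x²<xy+y² = positive (below x²<xy+y²)
    ... | inj₂ x²≡xy+y² with equal x²≡xy+y²
    ...   | refl , refl = null

    ≥φ-by-squares : x * y + y * y ≤ x * x → NonNegφ (+ x) (- + y)
    ≥φ-by-squares xy+y²≤x² with ℕₚ.m≤n⇒m<n∨m≡n xy+y²≤x²
    ... | inj₁ xy+y²<x² = positive (above xy+y²<x²)
    ... | inj₂ xy+y²≡x² with equal (sym xy+y²≡x²)
    ...   | refl , refl = null

    <φ-or-≥φ : Posφ (- + x) (+ y) ⊎ NonNegφ (+ x) (- + y)
    <φ-or-≥φ with ℕₚ.<-cmp (x * x) (x * y + y * y)
    ... | tri< x²<xy+y² _ _ = inj₁ (below x²<xy+y²)
    ... | tri≈ _ x²≡xy+y² _ = inj₂ (≥φ-by-squares (ℕₚ.≤-reflexive (sym x²≡xy+y²)))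
    ... | tri> _ _ xy+y²<x² = inj₂ (positive (above xy+y²<x²))

  posφ-or-nonNegφ-neg : ∀ a b → Posφ a b ⊎ NonNegφ (- a) (- b)
  posφ-or-nonNegφ-neg (+ zero) (+ zero) = inj₂ null
  posφ-or-nonNegφ-neg (+ zero) +[1+ y ] = inj₁ (posφ-ℕ (s≤s z≤n))
  posφ-or-nonNegφ-neg +[1+ x ] (+ y) = inj₁ (posφ-ℕ (s≤s z≤n))
  posφ-or-nonNegφ-neg -[1+ x ] -[1+ y ] = inj₂ (positive (posφ-ℕ (s≤s z≤n)))
  posφ-or-nonNegφ-neg -[1+ x ] (+ y) = <φ-or-≥φ
  posφ-or-nonNegφ-neg (+ x) -[1+ y ] with <φ-or-≥φ {x} {suc y}
  ... | inj₁ x<[y+1]φ = inj₂ (positive x<[y+1]φ)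
  ... | inj₂ (positive x>[y+1]φ) = inj₁ x>[y+1]φ

module FloorBounds where
  open import Data.Nat using (_+_; _*_; _∸_; _≤_; _<_; _≤?_)
  open import Data.Nat.Tactic.RingSolver using (solve-∀)
  open ℤφ
  open ComparisonWithφ

  record FloorDivφ (n f : ℕ) : Set where
    field
      fφ≤n : NonNegφ (+ n) (- + f)
      n<[f+1]φ : Posφ (- + n) (+ suc f)

  record FloorMulφ (m q : ℕ) : Set where
    field
      q≤mφ : NonNegφ (- + q) (+ m)
      mφ<q+1 : Posφ (+ suc q) (- + m)

  floorDivφ-bounds : ∀ {n f} → IsFloorDivPhi n f → FloorDivφ n f
  floorDivφ-bounds {n} {f} (lower , upper) = record
    { fφ≤n = ≥φ-by-squares
        (ℕₚ.*-cancelˡ-≤ 4 (ℕₚ.+-cancelʳ-≤ (n * n) _ _ (subst₂ _≤_ (expand f n) (five n) lower)))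
    ; n<[f+1]φ = ComparedWithφ.below (comparedWithφ n (suc f))
        (ℕₚ.*-cancelˡ-< 4 _ _ (ℕₚ.+-cancelʳ-< (n * n) _ _ (subst₂ _<_ (five n) (expand-suc f n) upper)))
    }
    where
    expand : ∀ f n → (2 * f + n) * (2 * f + n) ≡ 4 * (n * f + f * f) + n * n
    expand = solve-∀
    expand-suc : ∀ f n → (2 * f + 2 + n) * (2 * f + 2 + n) ≡ 4 * (n * suc f + suc f * suc f) + n * n
    expand-suc = solve-∀
    five : ∀ n → 5 * (n * n) ≡ 4 * (n * n) + n * n
    five = solve-∀

  floorDivφ-zero : ∀ {f} → IsFloorDivPhi 0 f → f ≡ 0
  floorDivφ-zero {zero} _ = refl
  floorDivφ-zero {suc f} (() , _)

  -- with 2a = m + s:  4(a² − am − m²) = s² − 5m²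
  module _ (a m s : ℕ) (m+s≡2a : m + s ≡ 2 * a) where
    private
      square : 4 * (a * a) ≡ s * s + (m * m + 2 * (m * s))
      square = trans (lemma a) (trans (cong (λ x → x * x) (sym m+s≡2a)) (lemma′ m s))
        where
        lemma : ∀ a → 4 * (a * a) ≡ (2 * a) * (2 * a)
        lemma = solve-∀
        lemma′ : ∀ m s → (m + s) * (m + s) ≡ s * s + (m * m + 2 * (m * s))
        lemma′ = solve-∀
      cross : 4 * (a * m + m * m) ≡ 5 * (m * m) + (m * m + 2 * (m * s))
      cross = trans (lemma a m) (trans (cong (λ x → 2 * (x * m) + 4 * (m * m)) (sym m+s≡2a)) (lemma′ m s))
        where
        lemma : ∀ a m → 4 * (a * m + m * m) ≡ 2 * ((2 * a) * m) + 4 * (m * m)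
        lemma = solve-∀
        lemma′ : ∀ m s → 2 * ((m + s) * m) + 4 * (m * m) ≡ 5 * (m * m) + (m * m + 2 * (m * s))
        lemma′ = solve-∀

    ≤-from-discriminant : s * s ≤ 5 * (m * m) → a * a ≤ a * m + m * m
    ≤-from-discriminant h = ℕₚ.*-cancelˡ-≤ 4 (subst₂ _≤_ (sym square) (sym cross) (ℕₚ.+-monoˡ-≤ _ h))

    >-from-discriminant : 5 * (m * m) < s * s → a * m + m * m < a * a
    >-from-discriminant h = ℕₚ.*-cancelˡ-< 4 _ _ (subst₂ _<_ (sym cross) (sym square) (ℕₚ.+-monoˡ-< _ h))

  floorMulφ-bounds : ∀ {m q} → IsFloorMulPhi m q → FloorMulφ m q
  floorMulφ-bounds {m} {q} (lower , m<2q+2 , upper) = record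
    { q≤mφ = q≤mφ
    ; mφ<q+1 = ComparedWithφ.above (comparedWithφ (suc q) m)
        (>-from-discriminant (suc q) m _ (trans (ℕₚ.m+[n∸m]≡n (ℕₚ.<⇒≤ m<2q+2)) (twice-suc q)) upper)
    }
    where
    twice-suc : ∀ q → 2 * q + 2 ≡ 2 * suc q
    twice-suc = solve-∀
    q≤mφ : NonNegφ (- + q) (+ m)
    q≤mφ with m ≤? 2 * q
    ... | yes m≤2q = ≤φ-by-squares (≤-from-discriminant q m _ (ℕₚ.m+[n∸m]≡n m≤2q) lower)
    ... | no m≰2q = ≤φ-by-squares (ℕₚ.≤-trans (ℕₚ.*-monoʳ-≤ q q≤m) (ℕₚ.m≤m+n _ _))
      where
      q≤m : q ≤ m
      q≤m = ℕₚ.≤-trans (ℕₚ.m≤m+n q (q + 0)) (ℕₚ.<⇒≤ (ℕₚ.≰⇒> m≰2q))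

  floorMulφ²-split : ∀ {m p} → IsFloorMulPhi² m p → ∃[ q ] (p ≡ m + q × IsFloorMulPhi m q)
  floorMulφ²-split {m} {p} (lower , 3m<2p+2 , upper) with m ≤? p
  ... | no m≰p =
    contradiction 3m<2p+2 (ℕₚ.≤⇒≯ (ℕₚ.≤-trans 2p+2≤2m (ℕₚ.*-monoˡ-≤ m (s≤s (s≤s (z≤n {1}))))))
    where
    twice-suc : ∀ p → 2 * suc p ≡ 2 * p + 2
    twice-suc = solve-∀
    2p+2≤2m : 2 * p + 2 ≤ 2 * m
    2p+2≤2m = subst (_≤ 2 * m) (twice-suc p) (ℕₚ.*-monoʳ-≤ 2 (ℕₚ.≰⇒> m≰p))
  ... | yes m≤p with ℕₚ.m≤n⇒∃[o]m+o≡n m≤p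
  ...   | q , refl = q , refl ,
    subst (λ x → x * x ≤ 5 * (m * m)) (cancel-m (double m q)) lower ,
    ℕₚ.+-cancelˡ-< (2 * m) m (2 * q + 2) (subst₂ _<_ (three m) (double+2 m q) 3m<2p+2) ,
    subst (λ x → 5 * (m * m) < x * x) (cancel-m (double+2 m q)) upper
    where
    three : ∀ m → 3 * m ≡ 2 * m + m
    three = solve-∀
    double : ∀ m q → 2 * (m + q) ≡ 2 * m + 2 * q
    double = solve-∀
    double+2 : ∀ m q → 2 * (m + q) + 2 ≡ 2 * m + (2 * q + 2)
    double+2 = solve-∀
    cancel-m : ∀ {x y} → x ≡ 2 * m + y → x ∸ 3 * m ≡ y ∸ m
    cancel-m {y = y} refl = trans (cong (2 * m + y ∸_) (three m)) (ℕₚ.[m+n]∸[m+o]≡n∸o (2 * m) y m)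

module ChungGraham where
  open import Data.List.Relation.Unary.All using (All; []; _∷_)
  open import Data.Nat using (_+_; _≤_; _<_)

  -- Read from c₁ upwards; the flag records that a 2 has occurred since the last 0 (or is
  -- imagined just below c₁), so that no further 2 may come before the next 0.
  data Admissible : Bool → List ℕ → Set where
    []  : ∀ {b} → Admissible b []
    0∷_ : ∀ {b cs} → Admissible false cs → Admissible b (0 ∷ cs)
    1∷_ : ∀ {b cs} → Admissible b cs → Admissible b (1 ∷ cs)
    2∷_ : ∀ {cs} → Admissible true cs → Admissible false (2 ∷ cs)

  admissible-∷ : ∀ c {cs} → c < 3 → Admissible false cs → (c ≡ 2 → Admissible true cs) →
    Admissible false (c ∷ cs)
  admissible-∷ 0 _ a _ = 0∷ a
  admissible-∷ 1 _ a _ = 1∷ a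
  admissible-∷ 2 _ _ a = 2∷ a refl
  admissible-∷ (suc (suc (suc _))) (s≤s (s≤s (s≤s ()))) _ _

  admissible-blocked-∷ : ∀ c {cs} → c < 2 → Admissible false cs → (c ≡ 1 → Admissible true cs) →
    Admissible true (c ∷ cs)
  admissible-blocked-∷ 0 _ a _ = 0∷ a
  admissible-blocked-∷ 1 _ _ a = 1∷ a refl
  admissible-blocked-∷ (suc (suc _)) (s≤s (s≤s ())) _ _

  admissible-≤2 : ∀ {b cs} → Admissible b cs → All (_≤ 2) cs
  admissible-≤2 [] = []
  admissible-≤2 (0∷ a) = z≤n ∷ admissible-≤2 a
  admissible-≤2 (1∷ a) = s≤s z≤n ∷ admissible-≤2 a
  admissible-≤2 (2∷ a) = s≤s (s≤s z≤n) ∷ admissible-≤2 a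

  admissible-tail : ∀ {b c cs} → Admissible b (c ∷ cs) → ∃[ b′ ] Admissible b′ cs
  admissible-tail (0∷ a) = _ , a
  admissible-tail (1∷ a) = _ , a
  admissible-tail (2∷ a) = _ , a

  ZeroBetween : List ℕ → ℕ → ℕ → Set
  ZeroBetween cs j j′ = ∃[ j″ ] (j < j″ × j″ < j′ × digit cs j″ ≡ 0)

  zeroBetween-∷ : ∀ {c cs j j′} → ZeroBetween cs j j′ → ZeroBetween (c ∷ cs) (suc j) (suc j′)
  zeroBetween-∷ (suc j″ , j<j″ , j″<j′ , d≡0) = suc (suc j″) , s≤s j<j″ , s≤s j″<j′ , d≡0

  zeroBetween-weaken : ∀ {cs j j′} → ZeroBetween cs (suc j) j′ → ZeroBetween cs j j′
  zeroBetween-weaken (j″ , j<j″ , j″<j′ , d≡0) = j″ , ℕₚ.<-trans (ℕₚ.n<1+n _) j<j″ , j″<j′ , d≡0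

  -- position 0 holds the imagined 2 of a blocked list
  TwoAt : Bool → List ℕ → ℕ → Set
  TwoAt b cs j = (1 ≤ j × digit cs j ≡ 2) ⊎ (j ≡ 0 × b ≡ true)

  admissible-zeroBetween : ∀ {b cs} → Admissible b cs → ∀ j j′ → j < j′ →
    TwoAt b cs j → digit cs j′ ≡ 2 → ZeroBetween cs j j′
  admissible-zeroBetween [] j (suc j′) _ _ ()
  admissible-zeroBetween (0∷ a) j (suc zero) _ _ ()
  admissible-zeroBetween (1∷ a) j (suc zero) _ _ ()
  admissible-zeroBetween (2∷ a) zero (suc zero) _ (inj₂ (_ , ())) _
  admissible-zeroBetween (2∷ a) (suc j) (suc zero) (s≤s ()) _ _
  admissible-zeroBetween (0∷ a) zero (suc (suc j′)) _ _ _ = 1 , s≤s z≤n , s≤s (s≤s z≤n) , refl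
  admissible-zeroBetween (1∷ a) zero (suc (suc j′)) _ (inj₂ (_ , b≡true)) d≡2 = zeroBetween-weaken
    (zeroBetween-∷ (admissible-zeroBetween a zero (suc j′) (s≤s z≤n) (inj₂ (refl , b≡true)) d≡2))
  admissible-zeroBetween (2∷ a) zero (suc (suc j′)) _ (inj₂ (_ , ())) _
  admissible-zeroBetween (0∷ a) (suc zero) (suc (suc j′)) _ (inj₁ (_ , ())) _
  admissible-zeroBetween (1∷ a) (suc zero) (suc (suc j′)) _ (inj₁ (_ , ())) _
  admissible-zeroBetween (2∷ a) (suc zero) (suc (suc j′)) _ _ d≡2 =
    zeroBetween-∷ (admissible-zeroBetween a zero (suc j′) (s≤s z≤n) (inj₂ (refl , refl)) d≡2)
  admissible-zeroBetween {cs = _ ∷ _} a (suc (suc j)) (suc (suc j′)) (s≤s j<j′) (inj₁ (_ , d≡2)) d′≡2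
    with admissible-tail a
  ... | _ , a′ =
    zeroBetween-∷ (admissible-zeroBetween a′ (suc j) (suc j′) j<j′ (inj₁ (s≤s z≤n , d≡2)) d′≡2)

  admissible⇒IsCGRep : ∀ {cs} → Admissible false cs → IsCGRep cs
  admissible⇒IsCGRep a = admissible-≤2 a , λ j j′ 1≤j j<j′ d≡2 d′≡2 →
    admissible-zeroBetween a j j′ j<j′ (inj₁ (1≤j , d≡2)) d′≡2

  pad : ℕ → List ℕ → List ℕ
  pad m cs = replicate m 0 ++ cs

  admissible-pad : ∀ m {cs} → Admissible false cs → Admissible false (pad m cs)
  admissible-pad zero a = a
  admissible-pad (suc m) a = 0∷ admissible-pad m a

  digit-pad : ∀ m c cs → digit (pad m (c ∷ cs)) (suc m) ≡ c
  digit-pad zero c cs = refl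
  digit-pad (suc m) c cs = digit-pad m c cs

  digit-pad-below : ∀ m cs j → 1 ≤ j → j < suc m → digit (pad m cs) j ≡ 0
  digit-pad-below zero cs (suc zero) _ (s≤s ())
  digit-pad-below (suc m) cs (suc zero) _ _ = refl
  digit-pad-below (suc m) cs (suc (suc j)) _ (s≤s j<m) = digit-pad-below m cs (suc j) (s≤s z≤n) j<m

  valueFrom-pad : ∀ m j cs → valueFrom j (pad m cs) ≡ valueFrom (m + j) cs
  valueFrom-pad zero j cs = refl
  valueFrom-pad (suc m) j cs = trans (valueFrom-pad m (suc j) cs) (cong (λ i → valueFrom i cs) (ℕₚ.+-suc m j))

  inB-pad : ∀ k d cs → Admissible false (d ∷ cs) → 0 < valueFrom (suc k) (d ∷ cs) →
    InB d (suc k) (valueFrom (suc k) (d ∷ cs))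
  inB-pad k d cs a 0<x =
    0<x , pad k (d ∷ cs) , admissible⇒IsCGRep (admissible-pad k a) ,
    trans (valueFrom-pad k 1 (d ∷ cs)) (cong (λ i → valueFrom i (d ∷ cs)) (ℕₚ.+-comm k 1)) ,
    digit-pad k d cs , digit-pad-below k (d ∷ cs)

module DigitValues where
  open import Data.Nat using (_+_; _*_; _∸_; _≤_)
  open import Data.Nat.Tactic.RingSolver using (solve-∀)

  F-suc-positive : ∀ m → 1 ≤ F (suc m)
  F-suc-positive zero = s≤s z≤n
  F-suc-positive (suc m) = ℕₚ.≤-trans (F-suc-positive m) (ℕₚ.m≤m+n _ _)

  F-even-suc : ∀ k → F (2 * suc k) ≡ F (suc (2 * k)) + F (2 * k)
  F-even-suc k = cong F (index k)
    where
    index : ∀ k → 2 * suc k ≡ suc (suc (2 * k))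
    index = solve-∀

  F-even-suc-pred : ∀ k → F (2 * suc k ∸ 1) ≡ F (suc (2 * k))
  F-even-suc-pred k = cong (λ i → F (i ∸ 1)) (index k)
    where
    index : ∀ k → 2 * suc k ≡ suc (suc (2 * k))
    index = solve-∀

  F-even-step : ∀ j → F (2 * suc (suc j)) + F (2 * j) ≡ 3 * F (2 * suc j)
  F-even-step j = begin
    F (2 * suc (suc j)) + F (2 * j)  ≡⟨ cong (λ i → F i + F (2 * j)) (index₂ j) ⟩
    F (4 + 2 * j) + F (2 * j)        ≡⟨ unfold (F (suc (2 * j))) (F (2 * j)) ⟩
    3 * F (2 + 2 * j)                ≡⟨ cong (λ i → 3 * F i) (index₁ j) ⟨
    3 * F (2 * suc j)                ∎
    where
    open ≡-Reasoning
    index₂ : ∀ j → 2 * suc (suc j) ≡ 4 + 2 * j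
    index₂ = solve-∀
    index₁ : ∀ j → 2 * suc j ≡ 2 + 2 * j
    index₁ = solve-∀
    unfold : ∀ a b → (((a + b) + a) + (a + b)) + b ≡ 3 * (a + b)
    unfold = solve-∀

  valueFrom-step : ∀ j cs → valueFrom (suc (suc j)) cs + valueFrom j cs ≡ 3 * valueFrom (suc j) cs
  valueFrom-step j [] = refl
  valueFrom-step j (c ∷ cs) = begin
    (c * F (2 * suc (suc j)) + valueFrom (suc (suc (suc j))) cs) + (c * F (2 * j) + valueFrom (suc j) cs)
      ≡⟨ regroup c _ _ _ _ ⟩
    c * (F (2 * suc (suc j)) + F (2 * j)) + (valueFrom (suc (suc (suc j))) cs + valueFrom (suc j) cs)
      ≡⟨ cong₂ (λ x y → c * x + y) (F-even-step j) (valueFrom-step (suc j) cs) ⟩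
    c * (3 * F (2 * suc j)) + 3 * valueFrom (suc (suc j)) cs
      ≡⟨ factor c _ _ ⟩
    3 * (c * F (2 * suc j) + valueFrom (suc (suc j)) cs) ∎
    where
    open ≡-Reasoning
    regroup : ∀ c a b x y → (c * a + x) + (c * b + y) ≡ c * (a + b) + (x + y)
    regroup = solve-∀
    factor : ∀ c a x → c * (3 * a) + 3 * x ≡ 3 * (c * a + x)
    factor = solve-∀

  module _ (G : ℕ → ℕ) (G-step : ∀ j → G (suc (suc j)) + G j ≡ 3 * G (suc j)) where
    private
      next : ∀ g₀ g₁ g g′ g″ a b c d →
        g + g₀ * a ≡ g₁ * b → g′ + g₀ * b ≡ g₁ * c →
        g″ + g ≡ 3 * g′ → c + a ≡ 3 * b → d + b ≡ 3 * c →
        g″ + g₀ * c ≡ g₁ * d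
      next g₀ g₁ g g′ g″ a b c d eq eq′ g-step a-step b-step =
        ℕₚ.+-cancelʳ-≡ (g₁ * b) _ _ (begin
          (g″ + g₀ * c) + g₁ * b       ≡⟨ cong (_+_ (g″ + g₀ * c)) eq ⟨
          (g″ + g₀ * c) + (g + g₀ * a) ≡⟨ regroup g″ g₀ c g a ⟩
          (g″ + g) + g₀ * (c + a)      ≡⟨ cong₂ (λ x y → x + g₀ * y) g-step a-step ⟩
          3 * g′ + g₀ * (3 * b)        ≡⟨ factor g′ g₀ b ⟩
          3 * (g′ + g₀ * b)            ≡⟨ cong (3 *_) eq′ ⟩
          3 * (g₁ * c)                 ≡⟨ swap g₁ c ⟩
          g₁ * (3 * c)                 ≡⟨ cong (g₁ *_) b-step ⟨
          g₁ * (d + b)                 ≡⟨ ℕₚ.*-distribˡ-+ g₁ d b ⟩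
          g₁ * d + g₁ * b              ∎)
        where
        open ≡-Reasoning
        regroup : ∀ g″ g₀ c g a → (g″ + g₀ * c) + (g + g₀ * a) ≡ (g″ + g) + g₀ * (c + a)
        regroup = solve-∀
        factor : ∀ g′ g₀ b → 3 * g′ + g₀ * (3 * b) ≡ 3 * (g′ + g₀ * b)
        factor = solve-∀
        swap : ∀ g₁ c → 3 * (g₁ * c) ≡ g₁ * (3 * c)
        swap = solve-∀

      closedForm-pair : ∀ j → (G (suc j) + G 0 * F (2 * j) ≡ G 1 * F (2 * suc j))
                            × (G (suc (suc j)) + G 0 * F (2 * suc j) ≡ G 1 * F (2 * suc (suc j)))
      closedForm-pair zero = base (G 1) (G 0) , trans (cong (_+_ (G 2)) (ℕₚ.*-identityʳ (G 0))) step
        where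
        base : ∀ x y → x + y * 0 ≡ x * 1
        base = solve-∀
        step : G 2 + G 0 ≡ G 1 * 3
        step = trans (G-step 0) (ℕₚ.*-comm 3 (G 1))
      closedForm-pair (suc j) with closedForm-pair j
      ... | eq , eq′ = eq′ , next (G 0) (G 1) (G (1 + j)) (G (2 + j)) (G (3 + j))
        (F (2 * j)) (F (2 * (1 + j))) (F (2 * (2 + j))) (F (2 * (3 + j)))
        eq eq′ (G-step (suc j)) (F-even-step j) (F-even-step (suc j))

    closedForm : ∀ j → G (suc j) + G 0 * F (2 * j) ≡ G 1 * F (2 * suc j)
    closedForm j = proj₁ (closedForm-pair j)

  valueFrom-closedForm : ∀ k cs → valueFrom (suc k) cs + valueFrom 0 cs * F (2 * k) ≡ value cs * F (2 * suc k)
  valueFrom-closedForm k cs = closedForm (λ j → valueFrom j cs) (λ j → valueFrom-step j cs) k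

  valueFrom-0-∷ : ∀ d cs → valueFrom 0 (d ∷ cs) ≡ value cs
  valueFrom-0-∷ d cs = cong (_+ value cs) (ℕₚ.*-zeroʳ d)

  value-∷ : ∀ d cs → value (d ∷ cs) + valueFrom 0 cs ≡ d + 3 * value cs
  value-∷ d cs = begin
    (d * 1 + valueFrom 2 cs) + valueFrom 0 cs  ≡⟨ ℕₚ.+-assoc (d * 1) _ _ ⟩
    d * 1 + (valueFrom 2 cs + valueFrom 0 cs)  ≡⟨ cong₂ _+_ (ℕₚ.*-identityʳ d) (valueFrom-step 0 cs) ⟩
    d + 3 * value cs                           ∎
    where open ≡-Reasoning

module ShiftedFloor where
  open import Data.Integer using (_+_; _<_)
  open import Data.Integer.Tactic.RingSolver using (solve; solve-∀)
  open ℤφ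
  open ComparisonWithφ using (posφ-or-nonNegφ-neg)

  -- v = ⌊N/φ²⌋, i.e. vφ² ≤ N < (v + 1)φ², where φ² = 1 + φ
  record IsFloorDivφ² (N v : ℤ) : Set where
    constructor _,_
    field
      lower : NonNegφ (N - v) (- v)
      upper : Posφ (v + 1ℤ - N) (v + 1ℤ)

  -- N < vφ² + φ
  record SmallRemainder (N v : ℤ) : Set where
    constructor small
    field
      remainder<φ : Posφ (v - N) (v + 1ℤ)

  isFloorDivφ²-suc-same : ∀ {N v} → IsFloorDivφ² N v → Posφ (v + 1ℤ - (1ℤ + N)) (v + 1ℤ) →
    IsFloorDivφ² (1ℤ + N) v
  isFloorDivφ²-suc-same {N} {v} (N≥vφ² , _) N+1<[v+1]φ² =
    positive (posφ-cong (posφ-+-nonNegφ posφ-1 N≥vφ²) (solve (N ∷ v ∷ [])) (solve (v ∷ []))) ,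
    N+1<[v+1]φ²

  -- (v + 2)φ² = (v + 1)φ² + 1 + φ
  isFloorDivφ²-suc-next : ∀ {N v} → IsFloorDivφ² N v → NonNegφ (- (v + 1ℤ - (1ℤ + N))) (- (v + 1ℤ)) →
    IsFloorDivφ² (1ℤ + N) (1ℤ + v)
  isFloorDivφ²-suc-next {N} {v} (_ , N<[v+1]φ²) N+1≥[v+1]φ² =
    nonNegφ-cong N+1≥[v+1]φ² (solve (N ∷ v ∷ [])) (solve (v ∷ [])) ,
    posφ-cong (posφ-+ N<[v+1]φ² posφ-φ) (solve (N ∷ v ∷ [])) (solve (v ∷ []))

  isFloorDivφ²-exists : ∀ N → ∃[ v ] IsFloorDivφ² (+ N) (+ v)
  isFloorDivφ²-exists zero = 0 , null , posφ-ℕ (s≤s z≤n)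
  isFloorDivφ²-exists (suc N) with isFloorDivφ²-exists N
  ... | v , floor with posφ-or-nonNegφ-neg (+ v + 1ℤ - (1ℤ + + N)) (+ v + 1ℤ)
  ...   | inj₁ N+1<[v+1]φ² = v , isFloorDivφ²-suc-same {+ N} {+ v} floor N+1<[v+1]φ²
  ...   | inj₂ N+1≥[v+1]φ² = suc v , isFloorDivφ²-suc-next {+ N} {+ v} floor N+1≥[v+1]φ²

  v<N-from-floor : ∀ {N v} → Posφ +0 v → NonNegφ (N - v) (- v) → v < N
  v<N-from-floor {N} {v} 0<vφ N≥vφ² =
    <-from-posφ (posφ-+-nonNegφ 0<vφ N≥vφ²) (solve (N ∷ v ∷ [])) (solve (v ∷ []))

  floorDivφ²-zero : ∀ {w} → IsFloorDivφ² +0 (+ w) → w ≡ 0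
  floorDivφ²-zero {zero} _ = refl
  floorDivφ²-zero {suc w} (wφ²≤0 , _)
    with ℤₚ.drop‿+<+ (v<N-from-floor {+0} {+ suc w} (posφ-ℕ (s≤s z≤n)) wφ²≤0)
  ... | ()

  -- In the following v = ⌊N/φ²⌋ and w = ⌊v/φ²⌋; note vφ² + v/φ² = 3v and 1/φ² = 2 − φ.
  N+w-lower : ∀ {N v w} → IsFloorDivφ² N v → IsFloorDivφ² v w → v + v + v < 1ℤ + (N + w)
  N+w-lower {N} {v} {w} (N≥vφ² , _) (_ , v<[w+1]φ²) =
    <-from-posφ (posφ-+-nonNegφ (posφ-/φ (posφ-/φ v<[w+1]φ²)) N≥vφ²)
      (solve (N ∷ v ∷ w ∷ [])) (solve (v ∷ w ∷ []))

  N+w-upper : ∀ {N v w} → IsFloorDivφ² N v → IsFloorDivφ² v w → N + w < + 3 + (v + v + v)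
  N+w-upper {N} {v} {w} (_ , N<[v+1]φ²) (w≤v/φ² , _) =
    <-from-posφ (posφ-+-nonNegφ (posφ-+ N<[v+1]φ² posφ-φ⁻²) (nonNegφ-/φ (nonNegφ-/φ w≤v/φ²)))
      (solve (N ∷ v ∷ w ∷ [])) (solve (v ∷ w ∷ []))

  N+w-upper-small : ∀ {N v w} → SmallRemainder N v → IsFloorDivφ² v w → N + w < + 2 + (v + v + v)
  N+w-upper-small {N} {v} {w} (small N<vφ²+φ) (w≤v/φ² , _) =
    <-from-posφ (posφ-+-nonNegφ (posφ-+ N<vφ²+φ posφ-φ⁻²) (nonNegφ-/φ (nonNegφ-/φ w≤v/φ²)))
      (solve (N ∷ v ∷ w ∷ [])) (solve (v ∷ w ∷ []))

  -- multiplying the upper bound on N by φ²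
  smallRemainder-N≡2+3v-w : ∀ {v w} → IsFloorDivφ² (+ 2 + (v + v + v) - w) v → SmallRemainder v w
  smallRemainder-N≡2+3v-w {v} {w} (_ , N<[v+1]φ²) =
    small (posφ-cong (posφ-*φ (posφ-*φ N<[v+1]φ²)) (solve (v ∷ w ∷ [])) (solve (v ∷ w ∷ [])))

  smallRemainder-N≡1+3v-w : ∀ {v w} → SmallRemainder (1ℤ + (v + v + v) - w) v → SmallRemainder v w
  smallRemainder-N≡1+3v-w {v} {w} (small N<vφ²+φ) =
    small (posφ-cong (posφ-*φ (posφ-*φ N<vφ²+φ)) (solve (v ∷ w ∷ [])) (solve (v ∷ w ∷ [])))

  m+n≡o⇒+m≡+o-+n : ∀ {m n o} → m ℕ.+ n ≡ o → + m ≡ + o - + n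
  m+n≡o⇒+m≡+o-+n {m} {n} refl = cancel (+ m) (+ n)
    where
    cancel : ∀ x y → x ≡ x + y - y
    cancel = solve-∀

module Representations where
  open import Data.Nat using (_+_; _*_; _∸_; _<_)
  open import Data.Nat.Tactic.RingSolver using (solve-∀)
  open ℤφ
  open ChungGraham
  open DigitValues
  open ShiftedFloor

  module _ {N v w : ℕ} (N-floor : IsFloorDivφ² (+ N) (+ v)) (v-floor : IsFloorDivφ² (+ v) (+ w)) where

    lowestDigit : ℕ
    lowestDigit = N + w ∸ (v + v + v)

    lowestDigit+3v : lowestDigit + (v + v + v) ≡ N + w
    lowestDigit+3v = ℕₚ.m∸n+n≡m (ℕₚ.m<1+n⇒m≤n (ℤₚ.drop‿+<+ (N+w-lower N-floor v-floor)))

    lowestDigit<3 : lowestDigit < 3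
    lowestDigit<3 = ℕₚ.+-cancelʳ-< (v + v + v) _ _
      (subst (_< 3 + (v + v + v)) (sym lowestDigit+3v) (ℤₚ.drop‿+<+ (N+w-upper N-floor v-floor)))

    lowestDigit<2 : SmallRemainder (+ N) (+ v) → lowestDigit < 2
    lowestDigit<2 N-small = ℕₚ.+-cancelʳ-< (v + v + v) _ _
      (subst (_< 2 + (v + v + v)) (sym lowestDigit+3v) (ℤₚ.drop‿+<+ (N+w-upper-small N-small v-floor)))

    private
      N≡ : ∀ {d} → lowestDigit ≡ d → + N ≡ + (d + (v + v + v)) - + w
      N≡ refl = m+n≡o⇒+m≡+o-+n (sym lowestDigit+3v)

    lowestDigit≡2⇒small : lowestDigit ≡ 2 → SmallRemainder (+ v) (+ w)
    lowestDigit≡2⇒small c≡2 =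
      smallRemainder-N≡2+3v-w (subst (λ N → IsFloorDivφ² N (+ v)) (N≡ c≡2) N-floor)

    lowestDigit≡1⇒small : SmallRemainder (+ N) (+ v) → lowestDigit ≡ 1 → SmallRemainder (+ v) (+ w)
    lowestDigit≡1⇒small N-small c≡1 =
      smallRemainder-N≡1+3v-w (subst (λ N → SmallRemainder N (+ v)) (N≡ c≡1) N-small)

  -- If N lies within φ of ⌊N/φ²⌋φ², the representation may be preceded by a 2.
  record Representation (N : ℕ) : Set where
    field
      digits : List ℕ
      admissible : Admissible false digits
      value≡ : value digits ≡ N
      floor : IsFloorDivφ² (+ N) (+ valueFrom 0 digits)
      blocked-if-small : SmallRemainder (+ N) (+ valueFrom 0 digits) → Admissible true digits

  representation-∷ : ∀ {N v} → IsFloorDivφ² (+ N) (+ v) → Representation v → Representation N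
  representation-∷ {N} {v} N-floor r = record
    { digits = c ∷ digits
    ; admissible = admissible-∷ c (lowestDigit<3 N-floor floor) admissible
        (λ c≡2 → blocked-if-small (lowestDigit≡2⇒small N-floor floor c≡2))
    ; value≡ = ℕₚ.+-cancelʳ-≡ w _ _ value+w≡N+w
    ; floor = subst (λ x → IsFloorDivφ² (+ N) (+ x)) (sym shifted≡v) N-floor
    ; blocked-if-small = λ N-small →
        let N-small′ = subst (λ x → SmallRemainder (+ N) (+ x)) shifted≡v N-small in
        admissible-blocked-∷ c (lowestDigit<2 N-floor floor N-small′) admissible
          (λ c≡1 → blocked-if-small (lowestDigit≡1⇒small N-floor floor N-small′ c≡1))
    }
    where
    open Representation r
    w = valueFrom 0 digits
    c = lowestDigit N-floor floor
    shifted≡v : valueFrom 0 (c ∷ digits) ≡ v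
    shifted≡v = trans (valueFrom-0-∷ c digits) value≡
    three : ∀ v → 3 * v ≡ v + v + v
    three = solve-∀
    value+w≡N+w : value (c ∷ digits) + w ≡ N + w
    value+w≡N+w = begin
      value (c ∷ digits) + w  ≡⟨ value-∷ c digits ⟩
      c + 3 * value digits    ≡⟨ cong (λ x → c + 3 * x) value≡ ⟩
      c + 3 * v               ≡⟨ cong (_+_ c) (three v) ⟩
      c + (v + v + v)         ≡⟨ lowestDigit+3v N-floor floor ⟩
      N + w                   ∎
      where open ≡-Reasoning

  representation : ∀ N → Representation N
  representation = <-rec Representation step
    where
    step : ∀ N → (∀ {v} → v < N → Representation v) → Representation N
    step zero _ = record
      { digits = [] ; admissible = [] ; value≡ = refl
      ; floor = null , posφ-ℕ (s≤s z≤n) ; blocked-if-small = λ _ → [] }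
    step (suc N) rec with isFloorDivφ²-exists (suc N)
    ... | zero , N-floor = representation-∷ N-floor (rec (s≤s z≤n))
    ... | suc v , N-floor = representation-∷ N-floor
      (rec (ℤₚ.drop‿+<+ (v<N-from-floor (posφ-ℕ (s≤s z≤n)) (IsFloorDivφ².lower N-floor))))

module SumBounds where
  open import Data.Integer using (_+_; _<_)
  open import Data.Integer.Tactic.RingSolver using (solve)
  open ℤφ
  open ShiftedFloor using (SmallRemainder; small)

  -- fφ + f/φ² = 2f
  sum-lower : ∀ {n f w} → NonNegφ n (- f) → Posφ (w + 1ℤ - f) (w + 1ℤ) → f + f < n + 1ℤ + w
  sum-lower {n} {f} {w} fφ≤n f<[w+1]φ² =
    <-from-posφ (posφ-+-nonNegφ (posφ-/φ (posφ-/φ f<[w+1]φ²)) fφ≤n)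
      (solve (n ∷ f ∷ w ∷ [])) (solve (f ∷ w ∷ []))

  sum-upper : ∀ {n f w} → Posφ (- n) (1ℤ + f) → NonNegφ (f - w) (- w) → n + 1ℤ + w < f + f + 1ℤ + + 2
  sum-upper {n} {f} {w} n<[f+1]φ wφ²≤f =
    <-from-posφ (posφ-+-nonNegφ (posφ-+ n<[f+1]φ posφ-φ⁻²) (nonNegφ-/φ (nonNegφ-/φ wφ²≤f)))
      (solve (n ∷ f ∷ w ∷ [])) (solve (f ∷ w ∷ []))

  -- n = q + 1 with q = ⌊mφ⌋: m < n/φ < f + 1 and f ≤ n/φ ≤ m + 1/φ
  floorDivφ-floorMulφ-suc-lower : ∀ {f m q} → Posφ (- (q + 1ℤ)) (1ℤ + f) → Posφ (1ℤ + q) (- m) → m < 1ℤ + f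
  floorDivφ-floorMulφ-suc-lower {f} {m} {q} n<[f+1]φ mφ<q+1 =
    <-from-posφ (posφ-/φ (posφ-+ n<[f+1]φ mφ<q+1))
      (solve (f ∷ m ∷ q ∷ [])) (solve (f ∷ m ∷ q ∷ []))

  floorDivφ-floorMulφ-suc-upper : ∀ {f m q} → NonNegφ (q + 1ℤ) (- f) → NonNegφ (- q) m → f < m + 1ℤ
  floorDivφ-floorMulφ-suc-upper {f} {m} {q} fφ≤n q≤mφ =
    <-from-posφ (posφ-+-nonNegφ (posφ-+-nonNegφ posφ-φ⁻² (nonNegφ-/φ fφ≤n)) (nonNegφ-/φ q≤mφ))
      (solve (f ∷ m ∷ q ∷ [])) (solve (f ∷ m ∷ q ∷ []))

  -- mφ + m/φ² = 2m
  sum-upper-floorMulφ : ∀ {m q w} → Posφ (- q) m → NonNegφ (m - w) (- w) → q + 1ℤ + 1ℤ + w < m + m + + 2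
  sum-upper-floorMulφ {m} {q} {w} q<mφ wφ²≤m =
    <-from-posφ (posφ-+-nonNegφ q<mφ (nonNegφ-/φ (nonNegφ-/φ wφ²≤m)))
      (solve (m ∷ q ∷ w ∷ [])) (solve (m ∷ w ∷ []))

  -- n = m + q + 1 with q = ⌊mφ⌋ lies in (qφ, (q + 1)φ), as m/φ lies in (q/φ², (q + 1)/φ²)
  floorDivφ-floorMulφ²-suc-upper : ∀ {f m q} → NonNegφ (m + q + 1ℤ) (- f) → Posφ (1ℤ + q) (- m) → f < 1ℤ + q
  floorDivφ-floorMulφ²-suc-upper {f} {m} {q} fφ≤n mφ<q+1 =
    <-from-posφ (posφ-/φ (posφ-+-nonNegφ (posφ-/φ mφ<q+1) fφ≤n))
      (solve (f ∷ m ∷ q ∷ [])) (solve (f ∷ m ∷ q ∷ []))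

  floorDivφ-floorMulφ²-suc-lower : ∀ {f m q} → Posφ (- (m + q + 1ℤ)) (1ℤ + f) → NonNegφ (- q) m → q < f + 1ℤ
  floorDivφ-floorMulφ²-suc-lower {f} {m} {q} n<[f+1]φ q≤mφ =
    <-from-posφ (posφ-/φ (posφ-+-nonNegφ (posφ-+ n<[f+1]φ posφ-1) (nonNegφ-/φ q≤mφ)))
      (solve (f ∷ m ∷ q ∷ [])) (solve (f ∷ m ∷ q ∷ []))

  -- q/φ + q/φ² = q
  sum-lower-floorMulφ² : ∀ {m q w} → NonNegφ (- q) m → Posφ (w + 1ℤ - q) (w + 1ℤ) →
    q + q + 1ℤ < m + q + 1ℤ + 1ℤ + w
  sum-lower-floorMulφ² {m} {q} {w} q≤mφ q<[w+1]φ² =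
    <-from-posφ (posφ-+-nonNegφ (posφ-/φ (posφ-/φ q<[w+1]φ²)) (nonNegφ-/φ q≤mφ))
      (solve (m ∷ q ∷ w ∷ [])) (solve (q ∷ w ∷ []))

  -- multiplying (f + 1)φ − n by φ², where n = 2f + 1 − w
  smallRemainder-sum : ∀ {n f w} → n + 1ℤ + w ≡ f + f + 1ℤ + 1ℤ → Posφ (- n) (1ℤ + f) → SmallRemainder f w
  smallRemainder-sum {n} {f} {w} s≡2f+2 n<[f+1]φ =
    small (posφ-cong (posφ-*φ (posφ-*φ (subst (λ n → Posφ (- n) (1ℤ + f)) n≡ n<[f+1]φ)))
      (solve (f ∷ w ∷ [])) (solve (f ∷ w ∷ [])))
    where
    n≡ : n ≡ f + f + 1ℤ - w
    n≡ = begin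
      n                          ≡⟨ solve (n ∷ w ∷ []) ⟩
      n + 1ℤ + w - 1ℤ - w        ≡⟨ cong (λ s → s - 1ℤ - w) s≡2f+2 ⟩
      f + f + 1ℤ + 1ℤ - 1ℤ - w   ≡⟨ solve (f ∷ w ∷ []) ⟩
      f + f + 1ℤ - w             ∎
      where open ≡-Reasoning

open ℤφ
open FloorBounds
open ChungGraham
open DigitValues
open ShiftedFloor
open Representations
open SumBounds
open import Data.Nat using (_+_; _*_; _∸_; _≤_; _<_)
open import Data.Nat.Tactic.RingSolver using (solve-∀)

-- The hypothesis makes value (d ∷ t) = n + 1 + f, and d ∷ t at position k is then worth
-- (n + 1 + f)F_{2k} − f F_{2k−2}.
inB-from-representation : ∀ k n f d t → value t ≡ f → Admissible false (d ∷ t) →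
  n + 1 + valueFrom 0 t ≡ f + f + d →
  InB d (suc k) ((n + 1) * F (2 * suc k) + f * F (2 * suc k ∸ 1))
inB-from-representation k n f d t value≡f a s≡2f+d =
  subst (InB d (suc k)) x≡ (inB-pad k d t a (subst (0 <_) (sym x≡) 0<x))
  where
  open ≡-Reasoning
  w = valueFrom 0 t
  A = F (2 * k)
  B = F (suc (2 * k))
  regroup : ∀ d f → d + 3 * f ≡ (f + f + d) + f
  regroup = solve-∀
  swap : ∀ a w f → a + w + f ≡ a + f + w
  swap = solve-∀
  expand : ∀ a f A B → (a + f) * (B + A) ≡ (a * (B + A) + f * B) + f * A
  expand = solve-∀
  value≡ : value (d ∷ t) ≡ n + 1 + f
  value≡ = ℕₚ.+-cancelʳ-≡ w _ _ (begin
    value (d ∷ t) + w  ≡⟨ value-∷ d t ⟩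
    d + 3 * value t    ≡⟨ cong (λ v → d + 3 * v) value≡f ⟩
    d + 3 * f          ≡⟨ regroup d f ⟩
    (f + f + d) + f    ≡⟨ cong (_+ f) s≡2f+d ⟨
    (n + 1 + w) + f    ≡⟨ swap (n + 1) w f ⟩
    n + 1 + f + w      ∎)
  x≡ : valueFrom (suc k) (d ∷ t) ≡ (n + 1) * F (2 * suc k) + f * F (2 * suc k ∸ 1)
  x≡ = ℕₚ.+-cancelʳ-≡ (f * A) _ _ (begin
    valueFrom (suc k) (d ∷ t) + f * A
      ≡⟨ cong (λ v → valueFrom (suc k) (d ∷ t) + v * A) (trans (valueFrom-0-∷ d t) value≡f) ⟨
    valueFrom (suc k) (d ∷ t) + valueFrom 0 (d ∷ t) * A
      ≡⟨ valueFrom-closedForm k (d ∷ t) ⟩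
    value (d ∷ t) * F (2 * suc k)
      ≡⟨ cong₂ _*_ value≡ (F-even-suc k) ⟩
    (n + 1 + f) * (B + A)
      ≡⟨ expand (n + 1) f A B ⟩
    ((n + 1) * (B + A) + f * B) + f * A
      ≡⟨ cong₂ (λ x y → ((n + 1) * x + f * y) + f * A) (F-even-suc k) (F-even-suc-pred k) ⟨
    ((n + 1) * F (2 * suc k) + f * F (2 * suc k ∸ 1)) + f * A ∎)
  0<x : 0 < (n + 1) * F (2 * suc k) + f * F (2 * suc k ∸ 1)
  0<x = ℕₚ.≤-trans
    (ℕₚ.*-mono-≤ (ℕₚ.m≤n+m 1 n) (subst (1 ≤_) (sym (F-even-suc k)) (F-suc-positive (suc (2 * k)))))
    (ℕₚ.m≤m+n _ _)

squeeze : ∀ {a b} → a < b → b < a + 2 → b ≡ a + 1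
squeeze {a} {b} a<b b<a+2 =
  trans (ℕₚ.≤-antisym (ℕₚ.m<1+n⇒m≤n (subst (b <_) (ℕₚ.+-comm a 2) b<a+2)) a<b) (ℕₚ.+-comm 1 a)

antisym-<1+ : ∀ {a b} → a < 1 + b → b < a + 1 → a ≡ b
antisym-<1+ {a} {b} a<1+b b<a+1 =
  ℕₚ.≤-antisym (ℕₚ.m<1+n⇒m≤n a<1+b) (ℕₚ.m<1+n⇒m≤n (subst (b <_) (ℕₚ.+-comm a 1) b<a+1))

sum<-zero : ∀ {n f w} → n ≡ 0 → IsFloorDivPhi n f → IsFloorDivφ² (+ f) (+ w) → n + 1 + w < f + f + 2
sum<-zero {f = f} refl n-floor w-floor with floorDivφ-zero {f} n-floor
... | refl with floorDivφ²-zero w-floor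
...   | refl = s≤s (s≤s z≤n)

sum<-floorMulφ-suc : ∀ {n f w m q} → FloorMulφ (suc m) q → n ≡ q + 1 →
  FloorDivφ n f → IsFloorDivφ² (+ f) (+ w) → n + 1 + w < f + f + 2
sum<-floorMulφ-suc {n} {f} {w} {m} {q} m-floor refl n-floor w-floor =
  subst (λ x → q + 1 + 1 + w < x + x + 2) (sym f≡m)
    (ℤₚ.drop‿+<+ (sum-upper-floorMulφ (nonNegφ⇒posφ q≤mφ)
      (IsFloorDivφ².lower (subst (λ x → IsFloorDivφ² (+ x) (+ w)) f≡m w-floor))))
  where
  open FloorMulφ m-floor
  open FloorDivφ n-floor
  f≡m : f ≡ suc m
  f≡m = sym (antisym-<1+
    (ℤₚ.drop‿+<+ (floorDivφ-floorMulφ-suc-lower {+ f} {+ suc m} {+ q} n<[f+1]φ mφ<q+1))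
    (ℤₚ.drop‿+<+ (floorDivφ-floorMulφ-suc-upper {+ f} {+ suc m} {+ q} fφ≤n q≤mφ)))

sum≡-floorMulφ²-suc : ∀ {n f w m p} → IsFloorMulPhi² m p → n ≡ p + 1 →
  FloorDivφ n f → IsFloorDivφ² (+ f) (+ w) → n + 1 + w ≡ f + f + 1 + 1
sum≡-floorMulφ²-suc {n} {f} {w} {m} {p} m-floor² refl n-floor w-floor with floorMulφ²-split {m} {p} m-floor²
... | q , refl , m-floor = squeeze s>2f+1
  (ℤₚ.drop‿+<+ (sum-upper {+ (m + q + 1)} {+ f} {+ w} n<[f+1]φ (IsFloorDivφ².lower w-floor)))
  where
  open FloorMulφ (floorMulφ-bounds {m} {q} m-floor)
  open FloorDivφ n-floor
  f≡q : f ≡ q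
  f≡q = antisym-<1+
    (ℤₚ.drop‿+<+ (floorDivφ-floorMulφ²-suc-upper {+ f} {+ m} {+ q} fφ≤n mφ<q+1))
    (ℤₚ.drop‿+<+ (floorDivφ-floorMulφ²-suc-lower {+ f} {+ m} {+ q} n<[f+1]φ q≤mφ))
  s>2f+1 : f + f + 1 < m + q + 1 + 1 + w
  s>2f+1 = subst (λ x → x + x + 1 < m + q + 1 + 1 + w) (sym f≡q)
    (ℤₚ.drop‿+<+ (sum-lower-floorMulφ² {+ m} {+ q} {+ w} q≤mφ
      (IsFloorDivφ².upper (subst (λ x → IsFloorDivφ² (+ x) (+ w)) f≡q w-floor))))

theorem20 : ∀ (k n f : ℕ) → 1 ≤ k → IsFloorDivPhi n f →
    ((n ≡ 0 ⊎ ∃[ m ] ∃[ q ] (1 ≤ m × IsFloorMulPhi m q × n ≡ q + 1)) →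
       InB⁽¹⁾ k ((n + 1) * F (2 * k) + f * F (2 * k ∸ 1)))
    × ((∃[ m ] ∃[ q ] (IsFloorMulPhi² m q × n ≡ q + 1)) →
       InB⁽²⁾ k ((n + 1) * F (2 * k) + f * F (2 * k ∸ 1)))
theorem20 zero n f () _
theorem20 (suc k) n f _ n-floor = inB⁽¹⁾ , inB⁽²⁾
  where
  open Representation (representation f)
  n-bounds = floorDivφ-bounds {n} {f} n-floor
  open FloorDivφ n-bounds
  w = valueFrom 0 digits

  s>2f : f + f < n + 1 + w
  s>2f = ℤₚ.drop‿+<+ (sum-lower {+ n} {+ f} {+ w} fφ≤n (IsFloorDivφ².upper floor))

  inB⁽¹⁾ : (n ≡ 0 ⊎ ∃[ m ] ∃[ q ] (1 ≤ m × IsFloorMulPhi m q × n ≡ q + 1)) →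
    InB⁽¹⁾ (suc k) ((n + 1) * F (2 * suc k) + f * F (2 * suc k ∸ 1))
  inB⁽¹⁾ h = inB-from-representation k n f 1 digits value≡ (1∷ admissible) (squeeze s>2f (s<2f+2 h))
    where
    s<2f+2 : (n ≡ 0 ⊎ ∃[ m ] ∃[ q ] (1 ≤ m × IsFloorMulPhi m q × n ≡ q + 1)) → n + 1 + w < f + f + 2
    s<2f+2 (inj₁ n≡0) = sum<-zero n≡0 n-floor floor
    s<2f+2 (inj₂ (suc m , q , _ , m-floor , n≡q+1)) =
      sum<-floorMulφ-suc (floorMulφ-bounds {suc m} {q} m-floor) n≡q+1 n-bounds floor

  inB⁽²⁾ : (∃[ m ] ∃[ q ] (IsFloorMulPhi² m q × n ≡ q + 1)) →
    InB⁽²⁾ (suc k) ((n + 1) * F (2 * suc k) + f * F (2 * suc k ∸ 1))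
  inB⁽²⁾ (m , p , m-floor² , n≡p+1) = inB-from-representation k n f 2 digits value≡
    (2∷ blocked-if-small (smallRemainder-sum {+ n} {+ f} {+ w} (cong +_ s≡2f+2) n<[f+1]φ))
    (trans s≡2f+2 (ℕₚ.+-assoc (f + f) 1 1))
    where
    s≡2f+2 : n + 1 + w ≡ f + f + 1 + 1
    s≡2f+2 = sum≡-floorMulφ²-suc {m = m} m-floor² n≡p+1 n-bounds floor
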